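{- Let $gp$ be a SPARQL graph pattern (built from triple patterns using $.$, $\mathtt{filter}$, braces, $\mathtt{minus}$, $\mathtt{diff}$, $\mathtt{graph}$) and $G$ a graph of the query dataset, and suppose all active graphs that are used for matching $gp$ in the translation $\sigma^G(gp)$ are nonempty. Then the set of free variables of the first-order formula $\sigma^G(gp)$ equals $\sigma_t(\mathrm{var}(gp))$.
   Context: $V,I,B,L$: disjoint sets of SPARQL variables, IRIs, blank nodes, literals. $\mathrm{var}$: variables/blank nodes occurring in a triple pattern $s\,p\,o$; $\mathrm{var}(gp_1.gp_2)=\mathrm{var}(gp_1)\cup\mathrm{var}(gp_2)$; for $gp_1\ \mathtt{filter}\ R$, $\{gp_1\}$, $gp_1\ \mathtt{minus}\ gp_2$, $gp_1\ \mathtt{diff}\ gp_2$, $\mathtt{graph}\ i\{gp_1\}$ it is $\mathrm{var}(gp_1)$; $\mathrm{var}(\mathtt{graph}\ x\{gp_1\})=\mathrm{var}(gp_1)\cup\{x\}$; for conditions/expressions it is the set of variables occurring. It is assumed $\mathrm{var}(R)\subseteq\mathrm{var}(gp_1)$ in every $gp_1\ \mathtt{filter}\ R$. $\sigma_t$ is a bijection mapping IRIs/literals to first-order constants and elements of $V\cup B$ to distinct first-order variables. $\sigma$ maps expressions/conditions homomorphically: $\sigma(\mathtt{datatype}(E))=datatype(\sigma E)$, $E_1=E_2\mapsto\sigma E_1=\sigma E_2$, $!,\&\&,||\mapsto\neg,\wedge,\vee$, $\mathtt{isliteral}(E)\mapsto isliteral(\sigma E)$. For a query over dataset $\mathbb{D}$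 with query dataset $D$ (obtained from $\mathtt{from}$/$\mathtt{from\ named}$ clauses): $cx(G)$ is undefined if $G$ is the default graph of $\mathbb{D}=D$; if $G$ is the default graph of $D\neq\mathbb{D}$ it is $\{\sigma_t(j)\}$ for the $\mathtt{from}$ IRIs $j$ (empty if $G$ empty); if $G=gr_{\mathbb{D}}(i)$ is a named graph of $D$ it is $\{\sigma_t(i)\}$; $I_n=\sigma_t(names(D))$. $\sigma^G(s\,p\,o)=\beta_d(\sigma s,\sigma p,\sigma o)$ if $cx(G)$ undefined, $\bigvee_{c\in cx(G)}\beta_n(\sigma s,\sigma p,\sigma o,c)$ if $cx(G)\neq\emptyset$, $\bot$ otherwise; $\sigma^G(gp_1.gp_2)=\sigma^G(gp_1)\wedge\sigma^G(gp_2)$; $\sigma^G(gp\ \mathtt{filter}\ R)=\sigma^G(gp)\wedge\sigma(R)$; $\sigma^G(\{gp\})=\sigma^G(gp)$; $\sigma^G(gp_1\ \mathtt{minus}\ gp_2)=\sigma^G(gp_1)$ if $\mathrm{var}(gp_1)\cap\mathrm{var}(gp_2)=\emptyset$, else $\sigma^G(gp_1)\wedge\forall\bar x\neg\sigma^G(gp_2)$; $\sigma^G(gp_1\ \mathtt{diff}\ gp_2)=\sigma^G(gp_1)\wedge\forall\bar x\neg\sigma^G(gp_2)$, $\bar x$ the free variables of $\sigma^G(gp_2)$ not free in $\sigma^G(gp_1)$; $\sigma^G(\mathtt{graph}\ x\{gp_1\})=\bigvee_{c\in I_n}(\sigma^{gr_D(\sigma_t^{ -1}(c))}(gp_1)\wedge\sigma(x)=c)$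 ($\bot$ if $I_n=\emptyset$); $\sigma^G(\mathtt{graph}\ i\{gp_1\})=\sigma^{gr_D(i)}(gp_1)$ if $\sigma_t(i)\in I_n$, else $\bot$. The active graphs used for matching $gp$ are $G$ and the graphs $gr_D(\cdot)$ arising in the $\mathtt{graph}$ clauses (the case $I_n=\emptyset$ or $i\notin names(D)$ counts as an empty active graph). -}

module Defs where

open import Data.Nat using (ℕ)
import Data.Nat as ℕ
open import Data.Bool using (Bool; true; false; if_then_else_)
open import Data.List using (List; []; _∷_; _++_; map; filter; concatMap)
open import Data.Bool.ListAction using (any)
open import Data.List.Membership.Propositional using (_∈_)
open import Data.List.Relation.Binary.Subset.Propositional using (_⊆_)
open import Data.List.Relation.Unary.All using (All)
open import Data.Maybe using (Maybe; just; nothing)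
open import Data.Product using (_×_; _,_; proj₁; proj₂)
open import Data.Unit using (⊤)
open import Relation.Binary.PropositionalEquality using (_≡_; _≢_; refl; cong)
open import Relation.Binary.Definitions using (DecidableEquality)
open import Relation.Nullary using (yes; no; ¬?; does)

-- SPARQL side.  The disjoint sets V, I, B, L are modelled by tagging
-- natural-number names with a constructor.

data Term : Set where
  tV : ℕ → Term
  tI : ℕ → Term
  tB : ℕ → Term
  tL : ℕ → Term

-- elements of V ∪ B (the things var(·) collects)
data VB : Set where
  v : ℕ → VB
  b : ℕ → VB

data Expr : Set where
  eV       : ℕ → Expr
  eI       : ℕ → Expr
  eL       : ℕ → Expr
  datatype : Expr → Expr

data Cond : Set where
  _==_      : Expr → Expr → Cond
  !_        : Cond → Cond
  _&&_      : Cond → Cond → Cond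
  _||_      : Cond → Cond → Cond
  isliteral : Expr → Cond

data GP : Set where
  tp     : Term → Term → Term → GP
  _∙_    : GP → GP → GP
  _filter_ : GP → Cond → GP
  brace  : GP → GP
  _minus_ : GP → GP → GP
  _diff_  : GP → GP → GP
  graphV : ℕ → GP → GP
  graphI : ℕ → GP → GP

varT : Term → List VB
varT (tV n) = v n ∷ []
varT (tI _) = []
varT (tB n) = b n ∷ []
varT (tL _) = []

varE : Expr → List VB
varE (eV n) = v n ∷ []
varE (eI _) = []
varE (eL _) = []
varE (datatype e) = varE e

varC : Cond → List VB
varC (e₁ == e₂) = varE e₁ ++ varE e₂
varC (! r) = varC r
varC (r₁ && r₂) = varC r₁ ++ varC r₂
varC (r₁ || r₂) = varC r₁ ++ varC r₂
varC (isliteral e) = varE e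

var : GP → List VB
var (tp s p o) = varT s ++ varT p ++ varT o
var (g₁ ∙ g₂) = var g₁ ++ var g₂
var (g filter _) = var g
var (brace g) = var g
var (g₁ minus _) = var g₁
var (g₁ diff _) = var g₁
var (graphV x g) = var g ++ (v x ∷ [])
var (graphI _ g) = var g

-- standing assumption: var(R) ⊆ var(gp1) in every  gp1 filter R
WF : GP → Set
WF (tp _ _ _) = ⊤
WF (g₁ ∙ g₂) = WF g₁ × WF g₂
WF (g filter r) = (varC r ⊆ var g) × WF g
WF (brace g) = WF g
WF (g₁ minus g₂) = WF g₁ × WF g₂
WF (g₁ diff g₂) = WF g₁ × WF g₂
WF (graphV _ g) = WF g
WF (graphI _ g) = WF g

data RDFTerm : Set where
  rI rB rL : ℕ → RDFTerm

Triple : Set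
Triple = RDFTerm × RDFTerm × RDFTerm

Graph : Set
Graph = List Triple

record Dataset : Set where
  field
    dflt  : Graph
    named : List (ℕ × Graph)   -- (IRI name, graph)
open Dataset public

names : Dataset → List ℕ
names D = map proj₁ (named D)

-- gr_D(i): the named graph with name i (empty if there is none)
gr : Dataset → ℕ → Graph
gr D i = go (named D)
  where
  go : List (ℕ × Graph) → Graph
  go [] = []
  go ((j , g) ∷ rest) = if does (i ℕ.≟ j) then g else go rest

data DSClauses : Set where
  noFrom  : DSClauses
  clauses : (from fromNamed : List ℕ) → DSClauses

queryDS : Dataset → DSClauses → Dataset
queryDS 𝔻 noFrom = 𝔻
queryDS 𝔻 (clauses fs fns) = record
  { dflt  = concatMap (gr 𝔻) fs
  ; named = map (λ i → (i , gr 𝔻 i)) fns }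

data GraphSel : Set where
  dfltG : GraphSel
  namedG : ℕ → GraphSel

IsGraphOf : Dataset → GraphSel → Set
IsGraphOf D dfltG = ⊤
IsGraphOf D (namedG i) = i ∈ names D

graphOf : Dataset → GraphSel → Graph
graphOf D dfltG = dflt D
graphOf D (namedG i) = gr D i

NonEmpty : Graph → Set
NonEmpty g = g ≢ []

data FOVar : Set where
  xV : ℕ → FOVar
  xB : ℕ → FOVar

data FOConst : Set where
  cI : ℕ → FOConst
  cL : ℕ → FOConst

data FOTerm : Set where
  var′      : FOVar → FOTerm
  con       : FOConst → FOTerm
  datatypeF : FOTerm → FOTerm

data Formula : Set where
  βd    : FOTerm → FOTerm → FOTerm → Formula
  βn    : FOTerm → FOTerm → FOTerm → FOTerm → Formula
  _≐_   : FOTerm → FOTerm → Formula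
  isliteralF : FOTerm → Formula
  ¬F_   : Formula → Formula
  _∧F_  : Formula → Formula → Formula
  _∨F_  : Formula → Formula → Formula
  ⊥F    : Formula
  ∀F    : List FOVar → Formula → Formula

_≟V_ : DecidableEquality FOVar
xV m ≟V xV n with m ℕ.≟ n
... | yes refl = yes refl
... | no ne = no λ { refl → ne refl }
xV _ ≟V xB _ = no λ ()
xB _ ≟V xV _ = no λ ()
xB m ≟V xB n with m ℕ.≟ n
... | yes refl = yes refl
... | no ne = no λ { refl → ne refl }

open import Data.List.Membership.DecPropositional _≟V_ using (_∈?_)

fvT : FOTerm → List FOVar
fvT (var′ x) = x ∷ []
fvT (con _) = []
fvT (datatypeF t) = fvT t

fv : Formula → List FOVar
fv (βd s p o) = fvT s ++ fvT p ++ fvT o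
fv (βn s p o c) = fvT s ++ fvT p ++ fvT o ++ fvT c
fv (t₁ ≐ t₂) = fvT t₁ ++ fvT t₂
fv (isliteralF t) = fvT t
fv (¬F φ) = fv φ
fv (φ ∧F ψ) = fv φ ++ fv ψ
fv (φ ∨F ψ) = fv φ ++ fv ψ
fv ⊥F = []
fv (∀F xs φ) = filter (λ y → ¬? (y ∈? xs)) (fv φ)

⋁ : List Formula → Formula
⋁ [] = ⊥F
⋁ (φ ∷ []) = φ
⋁ (φ ∷ ψs) = φ ∨F ⋁ ψs

σt : VB → FOVar
σt (v n) = xV n
σt (b n) = xB n

σT : Term → FOTerm
σT (tV n) = var′ (xV n)
σT (tI n) = con (cI n)
σT (tB n) = var′ (xB n)
σT (tL n) = con (cL n)

σE : Expr → FOTerm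
σE (eV n) = var′ (xV n)
σE (eI n) = con (cI n)
σE (eL n) = con (cL n)
σE (datatype e) = datatypeF (σE e)

σC : Cond → Formula
σC (e₁ == e₂) = σE e₁ ≐ σE e₂
σC (! r) = ¬F σC r
σC (r₁ && r₂) = σC r₁ ∧F σC r₂
σC (r₁ || r₂) = σC r₁ ∨F σC r₂
σC (isliteral e) = isliteralF (σE e)

-- cx(G); nothing = undefined
cx : DSClauses → GraphSel → Maybe (List FOConst)
cx noFrom dfltG = nothing
cx (clauses fs _) dfltG = just (map cI fs)
cx _ (namedG i) = just (cI i ∷ [])

_∈ᵇ_ : ℕ → List ℕ → Bool
i ∈ᵇ is = any (λ j → does (i ℕ.≟ j)) is

disjointᵇ : List VB → List VB → Bool
disjointᵇ xs ys = Data.Bool.not (any (λ x → any (λ y → eqVB x y) ys) xs)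
  where
  eqVB : VB → VB → Bool
  eqVB (v m) (v n) = does (m ℕ.≟ n)
  eqVB (b m) (b n) = does (m ℕ.≟ n)
  eqVB _ _ = false

module Translation (𝔻 : Dataset) (qc : DSClauses) where

  D : Dataset
  D = queryDS 𝔻 qc

  σ : GraphSel → GP → Formula
  σ G (tp s p o) with cx qc G
  ... | nothing = βd (σT s) (σT p) (σT o)
  ... | just cs = ⋁ (map (λ c → βn (σT s) (σT p) (σT o) (con c)) cs)
  σ G (g₁ ∙ g₂) = σ G g₁ ∧F σ G g₂
  σ G (g filter r) = σ G g ∧F σC r
  σ G (brace g) = σ G g
  σ G (g₁ minus g₂) =
    if disjointᵇ (var g₁) (var g₂)
    then σ G g₁
    else σ G g₁ ∧F ∀F (filter (λ y → ¬? (y ∈? fv (σ G g₁))) (fv (σ G g₂))) (¬F σ G g₂)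
  σ G (g₁ diff g₂) =
    σ G g₁ ∧F ∀F (filter (λ y → ¬? (y ∈? fv (σ G g₁))) (fv (σ G g₂))) (¬F σ G g₂)
  σ G (graphV x g) =
    ⋁ (map (λ i → σ (namedG i) g ∧F (var′ (xV x) ≐ con (cI i))) (names D))
  σ G (graphI i g) = if i ∈ᵇ names D then σ (namedG i) g else ⊥F

-- the graphs gr_D(·) arising in graph clauses of gp are all nonempty
-- (I_n = ∅, or i ∉ names(D), counts as an empty active graph)
GraphClausesNonEmpty : Dataset → GP → Set
GraphClausesNonEmpty D (tp _ _ _) = ⊤
GraphClausesNonEmpty D (g₁ ∙ g₂) = GraphClausesNonEmpty D g₁ × GraphClausesNonEmpty D g₂
GraphClausesNonEmpty D (g filter _) = GraphClausesNonEmpty D g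
GraphClausesNonEmpty D (brace g) = GraphClausesNonEmpty D g
GraphClausesNonEmpty D (g₁ minus g₂) = GraphClausesNonEmpty D g₁ × GraphClausesNonEmpty D g₂
GraphClausesNonEmpty D (g₁ diff g₂) = GraphClausesNonEmpty D g₁ × GraphClausesNonEmpty D g₂
GraphClausesNonEmpty D (graphV _ g) =
  (names D ≢ []) × All (λ i → NonEmpty (gr D i)) (names D) × GraphClausesNonEmpty D g
GraphClausesNonEmpty D (graphI i g) =
  (i ∈ names D) × NonEmpty (gr D i) × GraphClausesNonEmpty D g

ActiveGraphsNonEmpty : Dataset → GraphSel → GP → Set
ActiveGraphsNonEmpty D G gp = NonEmpty (graphOf D G) × GraphClausesNonEmpty D gp

-- Every construct passes on the free variables of its
-- parts, except that a filter only mentions variables already present (WF),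
-- the conjunct ∀ x̄ ¬ψ of minus/diff binds exactly the variables it would
-- add, and a disjunction over the constants of cx(G) or over names(D) has
-- the free variables of any one disjunct provided it is nonempty, which is
-- what the nonemptiness of the active graphs guarantees.
module Submission where

open import Defs
open import Data.List using (map)
open import Data.List.Membership.Propositional using (_∈_)
open import Function.Bundles using (_⇔_)

open import Data.Bool using (true; false)
open import Data.Bool.Properties using (T-≡)
open import Data.Empty using (⊥-elim)
open import Data.List using (List; []; _∷_; _++_; filter)
open import Data.List.Properties using (map-++; ++-identityʳ)
open import Data.List.Membership.Propositional.Properties
  using (∈-++⁻; ∈-++⁺ˡ; ∈-filter⁺; ∈-filter⁻)
open import Data.List.Membership.DecPropositional _≟V_ using (_∈?_)
open import Data.List.Relation.Binary.BagAndSetEquality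
  using (set; _∼[_]_; [_]-Equality; ++-cong; ++-idempotent)
open import Data.List.Relation.Binary.Subset.Propositional using (_⊆_)
open import Data.List.Relation.Binary.Subset.Propositional.Properties using (map⁺)
open import Data.List.Relation.Unary.Any using (here; there)
import Data.List.Relation.Unary.Any as Any
open import Data.List.Relation.Unary.Any.Properties using (any⁺)
import Data.List.Relation.Unary.All as All
open import Data.Maybe using (just; nothing)
open import Data.Nat.Properties using (≡⇒≡ᵇ)
open import Data.Product using (_,_)
open import Data.Sum using ([_,_]′)
open import Function.Base using (id; _∘_)
open import Function.Bundles using (Equivalence; mk⇔)
open import Function.Related.Propositional using (SymmetricKind)
open import Relation.Binary.Bundles using (Setoid)
open import Relation.Binary.PropositionalEquality
  using (_≡_; _≢_; refl; cong; cong₂; sym; trans; module ≡-Reasoning)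
import Relation.Binary.Reasoning.Setoid as SetReasoning
open import Relation.Nullary using (¬?)
open import Relation.Nullary.Decidable using (decidable-stable)

set-setoid : Setoid _ _
set-setoid = [ SymmetricKind.equivalence ]-Equality FOVar

open Setoid set-setoid using () renaming (refl to ∼-refl; trans to ∼-trans; reflexive to ∼-reflexive)

fv-σT : ∀ t → fvT (σT t) ≡ map σt (varT t)
fv-σT (tV _) = refl
fv-σT (tI _) = refl
fv-σT (tB _) = refl
fv-σT (tL _) = refl

fv-σE : ∀ e → fvT (σE e) ≡ map σt (varE e)
fv-σE (eV _) = refl
fv-σE (eI _) = refl
fv-σE (eL _) = refl
fv-σE (datatype e) = fv-σE e

fv-σC : ∀ r → fv (σC r) ≡ map σt (varC r)
fv-σC (e₁ == e₂) = trans (cong₂ _++_ (fv-σE e₁) (fv-σE e₂)) (sym (map-++ σt (varE e₁) (varE e₂)))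
fv-σC (! r) = fv-σC r
fv-σC (r₁ && r₂) = trans (cong₂ _++_ (fv-σC r₁) (fv-σC r₂)) (sym (map-++ σt (varC r₁) (varC r₂)))
fv-σC (r₁ || r₂) = trans (cong₂ _++_ (fv-σC r₁) (fv-σC r₂)) (sym (map-++ σt (varC r₁) (varC r₂)))
fv-σC (isliteral e) = fv-σE e

fv-σT-triple : ∀ s p o → fvT (σT s) ++ fvT (σT p) ++ fvT (σT o) ≡ map σt (var (tp s p o))
fv-σT-triple s p o = begin
  fvT (σT s) ++ fvT (σT p) ++ fvT (σT o)
    ≡⟨ cong₂ _++_ (fv-σT s) (cong₂ _++_ (fv-σT p) (fv-σT o)) ⟩
  map σt (varT s) ++ map σt (varT p) ++ map σt (varT o)
    ≡⟨ cong (map σt (varT s) ++_) (sym (map-++ σt (varT p) (varT o))) ⟩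
  map σt (varT s) ++ map σt (varT p ++ varT o)
    ≡⟨ sym (map-++ σt (varT s) (varT p ++ varT o)) ⟩
  map σt (var (tp s p o))
    ∎
  where open ≡-Reasoning

++-absorbʳ : ∀ {A : Set} {xs ys : List A} → ys ⊆ xs → xs ++ ys ∼[ set ] xs
++-absorbʳ {xs = xs} ys⊆xs = mk⇔ ([ id , ys⊆xs ]′ ∘ ∈-++⁻ xs) ∈-++⁺ˡ

fv-⋁-map : ∀ {A : Set} (f : A → Formula) {xs : List A} {L : List FOVar} → xs ≢ [] →
           (∀ {x} → x ∈ xs → fv (f x) ∼[ set ] L) → fv (⋁ (map f xs)) ∼[ set ] L
fv-⋁-map f {[]} xs≢[] _ = ⊥-elim (xs≢[] refl)
fv-⋁-map f {_ ∷ []} _ fv-f = fv-f (here refl)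
fv-⋁-map f {_ ∷ _ ∷ _} {L} _ fv-f =
  ∼-trans (++-cong (fv-f (here refl)) (fv-⋁-map f (λ ()) (fv-f ∘ there))) (++-idempotent L)

fv-∧-∀-fresh : ∀ φ ψ →
  fv (φ ∧F ∀F (filter (λ y → ¬? (y ∈? fv φ)) (fv ψ)) (¬F ψ)) ∼[ set ] fv φ
fv-∧-∀-fresh φ ψ = ++-absorbʳ bound⊆fvφ
  where
  fresh : List FOVar
  fresh = filter (λ y → ¬? (y ∈? fv φ)) (fv ψ)
  bound⊆fvφ : filter (λ y → ¬? (y ∈? fresh)) (fv ψ) ⊆ fv φ
  bound⊆fvφ {y} y∈ψ-fresh with ∈-filter⁻ (λ z → ¬? (z ∈? fresh)) {xs = fv ψ} y∈ψ-fresh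
  ... | y∈ψ , y∉fresh =
    decidable-stable (y ∈? fv φ) (y∉fresh ∘ ∈-filter⁺ (λ z → ¬? (z ∈? fv φ)) y∈ψ)

∈⇒∈ᵇ : ∀ {i is} → i ∈ is → i ∈ᵇ is ≡ true
∈⇒∈ᵇ {i} i∈is = Equivalence.to T-≡ (any⁺ _ (Any.map (λ { refl → ≡⇒≡ᵇ i i refl }) i∈is))

cx-nonempty : ∀ 𝔻 qc G {cs} → cx qc G ≡ just cs → NonEmpty (graphOf (queryDS 𝔻 qc) G) → cs ≢ []
cx-nonempty 𝔻 (clauses [] _) dfltG refl G≢[] = ⊥-elim (G≢[] refl)
cx-nonempty 𝔻 (clauses (_ ∷ _) _) dfltG refl _ ()
cx-nonempty 𝔻 noFrom (namedG _) refl _ ()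
cx-nonempty 𝔻 (clauses _ _) (namedG _) refl _ ()

module _ (𝔻 : Dataset) (qc : DSClauses) where
  open Translation 𝔻 qc

  fv-σ-tp : ∀ G s p o → NonEmpty (graphOf D G) → fv (σ G (tp s p o)) ∼[ set ] map σt (var (tp s p o))
  fv-σ-tp G s p o G≢[] with cx qc G in cx≡
  ... | nothing = ∼-reflexive (fv-σT-triple s p o)
  ... | just cs = fv-⋁-map _ (cx-nonempty 𝔻 qc G cx≡ G≢[]) λ _ → ∼-reflexive
          (trans (cong (λ l → fvT (σT s) ++ fvT (σT p) ++ l) (++-identityʳ (fvT (σT o))))
                 (fv-σT-triple s p o))

  fv-σ : ∀ G gp → WF gp → NonEmpty (graphOf D G) → GraphClausesNonEmpty D gp →
         fv (σ G gp) ∼[ set ] map σt (var gp)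
  fv-σ G (tp s p o) _ G≢[] _ = fv-σ-tp G s p o G≢[]
  fv-σ G (g₁ ∙ g₂) (wf₁ , wf₂) G≢[] (ne₁ , ne₂) =
    ∼-trans (++-cong (fv-σ G g₁ wf₁ G≢[] ne₁) (fv-σ G g₂ wf₂ G≢[] ne₂))
            (∼-reflexive (sym (map-++ σt (var g₁) (var g₂))))
  fv-σ G (g filter r) (r⊆g , wf) G≢[] ne = begin
    fv (σ G g) ++ fv (σC r)            ≈⟨ ++-cong (fv-σ G g wf G≢[] ne) (∼-reflexive (fv-σC r)) ⟩
    map σt (var g) ++ map σt (varC r)  ≈⟨ ++-absorbʳ (map⁺ σt r⊆g) ⟩
    map σt (var g)                     ∎
    where open SetReasoning set-setoid
  fv-σ G (brace g) wf G≢[] ne = fv-σ G g wf G≢[] ne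
  fv-σ G (g₁ minus g₂) (wf₁ , _) G≢[] (ne₁ , _) with disjointᵇ (var g₁) (var g₂)
  ... | true = fv-σ G g₁ wf₁ G≢[] ne₁
  ... | false = ∼-trans (fv-∧-∀-fresh (σ G g₁) (σ G g₂)) (fv-σ G g₁ wf₁ G≢[] ne₁)
  fv-σ G (g₁ diff g₂) (wf₁ , _) G≢[] (ne₁ , _) =
    ∼-trans (fv-∧-∀-fresh (σ G g₁) (σ G g₂)) (fv-σ G g₁ wf₁ G≢[] ne₁)
  fv-σ G (graphV x g) wf _ (names≢[] , named≢[] , ne) =
    ∼-trans (fv-⋁-map _ names≢[] λ i∈names →
               ++-cong (fv-σ (namedG _) g wf (All.lookup named≢[] i∈names) ne) ∼-refl)
            (∼-reflexive (sym (map-++ σt (var g) (v x ∷ []))))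
  fv-σ G (graphI i g) wf _ (i∈names , gr≢[] , ne) rewrite ∈⇒∈ᵇ i∈names =
    fv-σ (namedG i) g wf gr≢[] ne

lemma6 : (𝔻 : Dataset) (qc : DSClauses) (G : GraphSel) (gp : GP) →
         IsGraphOf (queryDS 𝔻 qc) G →
         WF gp →
         ActiveGraphsNonEmpty (queryDS 𝔻 qc) G gp →
         (y : FOVar) → (y ∈ fv (Translation.σ 𝔻 qc G gp) ⇔ y ∈ map σt (var gp))
lemma6 𝔻 qc G gp _ wf (G≢[] , ne) y = fv-σ 𝔻 qc G gp wf G≢[] ne
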